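{- For any two distinct vertices $x,y$ of the Farey graph $G_F$, the (model-theoretic) algebraic closure $\mathrm{acl}(\{x,y\})$ in $G_F$ is the whole vertex set of $G_F$.
   Context: The Farey graph $G_F$ is viewed as a structure in the language $\{E\}$ of graphs. $F_1$ is a single black edge contained in two triangles whose other sides are blue; $F_{n+1}$ is obtained from $F_n$ by adding, for every blue edge $e$ of $F_n$, a new vertex joined precisely to the endpoints of $e$ by two blue edges, and colouring all edges of $F_n$ black; $G_F=\bigcup_n F_n$ with colours forgotten. -}

module Defs where

open import Data.Nat using (ℕ; suc)
open import Data.Fin using (Fin; zero; suc)
open import Data.Product using (Σ; _×_; _,_; proj₁; proj₂)
open import Data.Sum using (_⊎_)
open import Data.List using (List)
open import Data.List.Membership.Propositional using (_∈_)
open import Data.Vec.Functional using (_∷_)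
open import Relation.Binary.PropositionalEquality using (_≡_)
open import Relation.Nullary using (¬_)

-- F₁ : black edge {A,B}; triangles A B C and A B D; blue edges
--      AC, BC, AD, BD.
-- Every blue edge e = (u,v) ever created gets a new vertex  mid e  and
-- two new blue edges (u, mid e) =: left e  and  (v, mid e) =: right e.
-- A blue edge is therefore a root blue edge of F₁ followed by a finite
-- sequence of left/right steps; new vertices correspond bijectively to
-- blue edges.  G_F = ⋃ F_n has as edges the black edge AB together with
-- every blue edge ever created (recolouring to black keeps the edge).

data BlueEdge : Set where
  root  : Fin 4 → BlueEdge
  left  : BlueEdge → BlueEdge
  right : BlueEdge → BlueEdge

data Vertex : Set where
  vA vB vC vD : Vertex
  mid         : BlueEdge → Vertex

ends : BlueEdge → Vertex × Vertex
ends (root zero)                   = vA , vC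
ends (root (suc zero))             = vB , vC
ends (root (suc (suc zero)))       = vA , vD
ends (root (suc (suc (suc zero)))) = vB , vD
ends (left e)  = proj₁ (ends e) , mid e
ends (right e) = proj₂ (ends e) , mid e

FareyE : Vertex → Vertex → Set
FareyE x y =
  ((x ≡ vA × y ≡ vB) ⊎ (x ≡ vB × y ≡ vA))
  ⊎ Σ BlueEdge (λ e → (ends e ≡ (x , y)) ⊎ (ends e ≡ (y , x)))

data Formula (n : ℕ) : Set where
  _≐_  : Fin n → Fin n → Formula n
  rel  : Fin n → Fin n → Formula n
  ¬'_  : Formula n → Formula n
  _∧'_ : Formula n → Formula n → Formula n
  _∨'_ : Formula n → Formula n → Formula n
  _⇒'_ : Formula n → Formula n → Formula n
  ∃'   : Formula (suc n) → Formula n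
  ∀'   : Formula (suc n) → Formula n

Sat : {V : Set} → (V → V → Set) → {n : ℕ} → Formula n → (Fin n → V) → Set
Sat E (i ≐ j)   ρ = ρ i ≡ ρ j
Sat E (rel i j) ρ = E (ρ i) (ρ j)
Sat E (¬' φ)    ρ = ¬ Sat E φ ρ
Sat E (φ ∧' ψ)  ρ = Sat E φ ρ × Sat E ψ ρ
Sat E (φ ∨' ψ)  ρ = Sat E φ ρ ⊎ Sat E ψ ρ
Sat E (φ ⇒' ψ)  ρ = Sat E φ ρ → Sat E ψ ρ
Sat {V} E (∃' φ) ρ = Σ V (λ v → Sat E φ (v ∷ ρ))
Sat {V} E (∀' φ) ρ = (v : V) → Sat E φ (v ∷ ρ)

-- Model-theoretic algebraic closure: z ∈ acl(A) iff there is a formula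
-- φ(x, ȳ) and parameters ā from A such that φ(z, ā) holds and the set
-- φ(M, ā) = { v | φ(v, ā) } is finite (contained in a finite list).
InAcl : {V : Set} → (V → V → Set) → (V → Set) → V → Set
InAcl {V} E A z =
  Σ ℕ λ k → Σ (Formula (suc k)) λ φ → Σ (Fin k → V) λ ps →
    ((i : Fin k) → A (ps i))
    × Sat E φ (z ∷ ps)
    × Σ (List V) (λ L → (v : V) → Sat E φ (v ∷ ps) → v ∈ L)

-- An edge of the Farey graph has only finitely many common neighbours, so
-- algebraic closure is closed under adding the apex of a triangle standing
-- on an edge it already contains.  Every vertex is reached from the initial
-- edge AB by adding apexes, and AB is recovered from any edge by walking
-- back down, so the algebraic closure of the two ends of an edge is
-- everything.
--
-- For a pair {x, y} other than {A, B}, let y be the later-born vertex.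
-- Its two parents separate its descendants, x not among them, from the rest
-- of the graph.  Hence the neighbours of y that are strictly closer to x
-- than y is form a nonempty set of parents of y, definable over {x, y} once
-- distances are cut off at d(y, x).  Each parent p is adjacent to y, so
-- everything is algebraic over {p, y}, and therefore over {x, y}.
module Submission where

open import Defs
open import Data.Bool using (Bool; false; true)
import Data.Bool.Properties as Bool
open import Data.Empty using (⊥-elim)
open import Data.Fin using (Fin; zero; suc; lift)
import Data.Fin.Properties as Fin
open import Data.List using (List; []; _∷_; _++_; concatMap)
import Data.List.Properties as List
open import Data.List.Membership.Propositional using (_∈_; lose)
open import Data.List.Membership.Propositional.Properties using (∈-++⁺ˡ; ∈-++⁺ʳ; ∈-concatMap⁺)
import Data.List.Membership.DecPropositional as DecMembership
open import Data.List.Relation.Unary.Any using (here; there)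
open import Data.Nat using (ℕ; zero; suc; _≤_; _<_; z≤n; s≤s)
open import Data.Nat.Properties using (≤-total; ≤-refl; m≤n⇒m≤1+n; m≤n⇒m<n∨m≡n; <-irrefl; <-≤-trans)
open import Data.Product using (Σ; _×_; _,_; proj₁; proj₂; map₂; swap; uncurry)
open import Data.Product.Function.Dependent.Propositional using (Σ-⇔)
open import Data.Product.Function.NonDependent.Propositional using (_×-⇔_)
import Data.Product.Properties as Product
open import Data.Sum using (_⊎_; inj₁; inj₂; [_,_]′)
import Data.Sum as Sum
open import Data.Sum.Function.Propositional using (_⊎-⇔_)
import Data.Sum.Properties as Sum
open import Data.Vec.Functional using () renaming (_∷_ to _∷ᵥ_; [] to []ᵥ)
open import Function using (_∘_; _⇔_; mk⇔; Equivalence)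
open import Function.Construct.Identity using (↠-id)
import Function.Properties.Equivalence as ⇔
open import Function.Related.TypeIsomorphisms using (¬-cong-⇔; →-cong-⇔)
open import Relation.Binary.Definitions using (DecidableEquality)
open import Relation.Binary.PropositionalEquality using (_≡_; _≢_; refl; sym; trans; cong; subst)
open import Relation.Nullary using (¬_; yes; no)
open import Relation.Nullary.Decidable using (map′; decidable-stable; ¬¬-excluded-middle)
open import Relation.Nullary.Negation using (¬¬-map)

open Equivalence using (to; from)

private
  variable
    n m k : ℕ

¬¬-jump : {P : ℕ → Set} → ¬ P 0 → P (suc m) → ¬ ¬ Σ ℕ λ d → d ≤ m × P (suc d) × ¬ P d
¬¬-jump {zero}  ¬P₀ P₁ ¬jump = ¬jump (0 , z≤n , P₁ , ¬P₀)
¬¬-jump {suc m} ¬P₀ P₂₊ₘ ¬jump = ¬¬-excluded-middle λ where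
  (yes P₁₊ₘ) → ¬¬-jump ¬P₀ P₁₊ₘ λ (d , d≤m , jump) → ¬jump (d , m≤n⇒m≤1+n d≤m , jump)
  (no ¬P₁₊ₘ) → ¬jump (suc m , ≤-refl , P₂₊ₘ , ¬P₁₊ₘ)

retract-≟ : {A B : Set} (encode : A → B) (decode : B → A) → (∀ a → decode (encode a) ≡ a) →
            DecidableEquality B → DecidableEquality A
retract-≟ encode decode retract _≟_ a a′ =
  map′ (λ eq → trans (sym (retract a)) (trans (cong decode eq) (retract a′))) (cong encode)
       (encode a ≟ encode a′)

subst₂-⇔ : {A : Set} (R : A → A → Set) {a a′ b b′ : A} → a′ ≡ a → b′ ≡ b → R a b ⇔ R a′ b′
subst₂-⇔ R refl refl = ⇔.refl

Π-⇔ : {A : Set} {B C : A → Set} → (∀ a → B a ⇔ C a) → (∀ a → B a) ⇔ (∀ a → C a)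
Π-⇔ B⇔C = mk⇔ (λ f a → to (B⇔C a) (f a)) (λ g a → from (B⇔C a) (g a))

rename : (Fin n → Fin m) → Formula n → Formula m
rename r (i ≐ j)  = r i ≐ r j
rename r (rel i j) = rel (r i) (r j)
rename r (¬' φ)   = ¬' rename r φ
rename r (φ ∧' ψ) = rename r φ ∧' rename r ψ
rename r (φ ∨' ψ) = rename r φ ∨' rename r ψ
rename r (φ ⇒' ψ) = rename r φ ⇒' rename r ψ
rename r (∃' φ)   = ∃' (rename (lift 1 r) φ)
rename r (∀' φ)   = ∀' (rename (lift 1 r) φ)

-- ∃u. φ(u, ȳ) ∧ ψ(x, u, ȳ)
compose : Formula (suc n) → Formula (suc (suc n)) → Formula (suc n)
compose φ ψ = ∃' (rename (lift 1 suc) φ ∧' rename (suc zero ∷ᵥ zero ∷ᵥ λ i → suc (suc i)) ψ)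

⋁ : (ℕ → Formula n) → ℕ → Formula n
⋁ f zero    = f zero
⋁ f (suc m) = ⋁ f m ∨' f (suc m)

reaches : ℕ → Fin n → Fin n → Formula n
reaches zero    a b = a ≐ b
reaches (suc k) a b = (a ≐ b) ∨' ∃' (rel (suc a) zero ∧' reaches k zero (suc b))

module Definability {V : Set} (E : V → V → Set) where

  private
    variable
      ρ : Fin n → V
      σ : Fin m → V
      a b u v z : V

  Bounded : Formula (suc n) → (Fin n → V) → Set
  Bounded φ ρ = Σ (List V) λ L → ∀ v → Sat E φ (v ∷ᵥ ρ) → v ∈ L

  UniformlyBounded : Formula (suc n) → Set
  UniformlyBounded φ = ∀ ρ → Bounded φ ρ

  Algebraic : (Fin n → V) → V → Set
  Algebraic ρ z = Σ (Formula _) λ φ → Sat E φ (z ∷ᵥ ρ) × Bounded φ ρ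

  UniformlyAlgebraic : (Fin n → V) → V → Set
  UniformlyAlgebraic ρ z = Σ (Formula _) λ φ → Sat E φ (z ∷ᵥ ρ) × UniformlyBounded φ

  TriangleClosed : (V → Set) → Set
  TriangleClosed S = ∀ {a b z} → E a b → E z a → E z b → S a → S b → S z

  -- walks of length at most k
  data Reach : ℕ → V → V → Set where
    done : Reach k v v
    step : E u v → Reach k v z → Reach (suc k) u z

  algebraic⇒InAcl : (A : V → Set) → (∀ i → A (ρ i)) → Algebraic ρ z → InAcl E A z
  algebraic⇒InAcl A ρ∈A (φ , sat , bounded) = _ , φ , _ , ρ∈A , sat , bounded

  uniformlyAlgebraic⇒algebraic : UniformlyAlgebraic ρ z → Algebraic ρ z
  uniformlyAlgebraic⇒algebraic (φ , sat , bounded) = φ , sat , bounded _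

  lift-agrees : {r : Fin n → Fin m} → (∀ i → σ (r i) ≡ ρ i) →
                ∀ v i → (v ∷ᵥ σ) (lift 1 r i) ≡ (v ∷ᵥ ρ) i
  lift-agrees σ∘r≡ρ v zero    = refl
  lift-agrees σ∘r≡ρ v (suc i) = σ∘r≡ρ i

  sat-rename : (r : Fin n → Fin m) (φ : Formula n) →
               (∀ i → σ (r i) ≡ ρ i) → Sat E φ ρ ⇔ Sat E (rename r φ) σ
  sat-rename r (i ≐ j)   σ∘r≡ρ = subst₂-⇔ _≡_ (σ∘r≡ρ i) (σ∘r≡ρ j)
  sat-rename r (rel i j) σ∘r≡ρ = subst₂-⇔ E (σ∘r≡ρ i) (σ∘r≡ρ j)
  sat-rename r (¬' φ)    σ∘r≡ρ = ¬-cong-⇔ (sat-rename r φ σ∘r≡ρ)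
  sat-rename r (φ ∧' ψ)  σ∘r≡ρ = sat-rename r φ σ∘r≡ρ ×-⇔ sat-rename r ψ σ∘r≡ρ
  sat-rename r (φ ∨' ψ)  σ∘r≡ρ = sat-rename r φ σ∘r≡ρ ⊎-⇔ sat-rename r ψ σ∘r≡ρ
  sat-rename r (φ ⇒' ψ)  σ∘r≡ρ = →-cong-⇔ (sat-rename r φ σ∘r≡ρ) (sat-rename r ψ σ∘r≡ρ)
  sat-rename r (∃' φ)    σ∘r≡ρ = Σ-⇔ (↠-id V) (sat-rename (lift 1 r) φ (lift-agrees σ∘r≡ρ _))
  sat-rename r (∀' φ)    σ∘r≡ρ = Π-⇔ λ v → sat-rename (lift 1 r) φ (lift-agrees σ∘r≡ρ v)

  sat-weaken : (φ : Formula (suc n)) {σ : Fin (suc n) → V} →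
               Sat E φ (v ∷ᵥ σ ∘ suc) ⇔ Sat E (rename (lift 1 suc) φ) (v ∷ᵥ σ)
  sat-weaken φ = sat-rename _ φ (λ { zero → refl ; (suc i) → refl })

  sat-compose : (φ : Formula (suc n)) (ψ : Formula (suc (suc n))) →
                Sat E (compose φ ψ) (z ∷ᵥ ρ) ⇔
                Σ V λ u → Sat E φ (u ∷ᵥ ρ) × Sat E ψ (z ∷ᵥ u ∷ᵥ ρ)
  sat-compose φ ψ = Σ-⇔ (↠-id V) (⇔.sym
    (sat-rename _ φ (λ { zero → refl ; (suc i) → refl }) ×-⇔
     sat-rename _ ψ (λ { zero → refl ; (suc zero) → refl ; (suc (suc i)) → refl })))

  bounded-compose : (φ : Formula (suc n)) (ψ : Formula (suc (suc n))) →
                    Bounded φ ρ → (∀ u → Bounded ψ (u ∷ᵥ ρ)) → Bounded (compose φ ψ) ρ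
  bounded-compose φ ψ (L , φ⊆L) ψ-bounded =
    concatMap (proj₁ ∘ ψ-bounded) L , λ v sat →
      let (u , φu , ψvu) = to (sat-compose φ ψ) sat
      in ∈-concatMap⁺ (proj₁ ∘ ψ-bounded) (lose (φ⊆L u φu) (proj₂ (ψ-bounded u) v ψvu))

  bounded-∨ : (φ ψ : Formula (suc n)) → UniformlyBounded φ → UniformlyBounded ψ → UniformlyBounded (φ ∨' ψ)
  bounded-∨ φ ψ φ-bounded ψ-bounded ρ =
    let (L , φ⊆L) = φ-bounded ρ ; (M , ψ⊆M) = ψ-bounded ρ
    in L ++ M , λ { v (inj₁ φv) → ∈-++⁺ˡ (φ⊆L v φv) ; v (inj₂ ψv) → ∈-++⁺ʳ L (ψ⊆M v ψv) }

  uniformlyAlgebraic-var : ∀ i → UniformlyAlgebraic ρ (ρ i)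
  uniformlyAlgebraic-var i = zero ≐ suc i , refl , λ ρ → ρ i ∷ [] , λ v v≡ρi → here v≡ρi

  uniformlyAlgebraic-weaken : UniformlyAlgebraic ρ a → UniformlyAlgebraic (u ∷ᵥ ρ) a
  uniformlyAlgebraic-weaken (φ , sat , bounded) =
    rename (lift 1 suc) φ , to (sat-weaken φ) sat , λ σ →
      let (L , φ⊆L) = bounded (σ ∘ suc)
      in L , λ v φv → φ⊆L v (from (sat-weaken φ) φv)

  uniformlyAlgebraic-trans : UniformlyAlgebraic ρ u → UniformlyAlgebraic (u ∷ᵥ ρ) z → UniformlyAlgebraic ρ z
  uniformlyAlgebraic-trans {u = u} (φ , φu , φ-bounded) (ψ , ψz , ψ-bounded) =
    compose φ ψ , from (sat-compose φ ψ) (u , φu , ψz) ,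
    λ ρ → bounded-compose φ ψ (φ-bounded ρ) (λ u → ψ-bounded (u ∷ᵥ ρ))

  uniformlyAlgebraic-triangle : (∀ a b → Σ (List V) λ L → ∀ v → E a b → E v a → E v b → v ∈ L) →
                                TriangleClosed (UniformlyAlgebraic ρ)
  uniformlyAlgebraic-triangle common-bounded {a} {b} {z} ab za zb a-alg b-alg =
    uniformlyAlgebraic-trans a-alg (uniformlyAlgebraic-trans (uniformlyAlgebraic-weaken b-alg) common)
    where
    common : UniformlyAlgebraic (b ∷ᵥ a ∷ᵥ ρ) z
    common = rel zero (suc zero) ∧' (rel zero (suc (suc zero)) ∧' rel (suc (suc zero)) (suc zero)) ,
             (zb , za , ab) ,
             λ ρ → let (L , common⊆L) = common-bounded (ρ (suc zero)) (ρ zero)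
                   in L , λ v (vb , va , ab) → common⊆L v ab va vb

  uniformlyAlgebraic-∨ : UniformlyAlgebraic (a ∷ᵥ ρ) z → UniformlyAlgebraic (b ∷ᵥ ρ) z →
                         Σ (Formula _) λ ψ → UniformlyBounded ψ ×
                                             (∀ {c} → c ≡ a ⊎ c ≡ b → Sat E ψ (z ∷ᵥ c ∷ᵥ ρ))
  uniformlyAlgebraic-∨ (φ , φz , φ-bounded) (ψ , ψz , ψ-bounded) =
    φ ∨' ψ , bounded-∨ φ ψ φ-bounded ψ-bounded ,
    λ { (inj₁ refl) → inj₁ φz ; (inj₂ refl) → inj₂ ψz }

  -- the witness u need only exist up to double negation: membership in a finite list is decidable
  algebraic-¬¬-trans : DecidableEquality V → (φ : Formula (suc n)) (ψ : Formula (suc (suc n))) →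
                       Bounded φ ρ → UniformlyBounded ψ →
                       ¬ ¬ (Σ V λ u → Sat E φ (u ∷ᵥ ρ) × Sat E ψ (z ∷ᵥ u ∷ᵥ ρ)) → Algebraic ρ z
  algebraic-¬¬-trans {ρ = ρ} _≟_ φ ψ φ-bounded ψ-bounded ¬¬witness =
    let (L , compose⊆L) = bounded-compose φ ψ φ-bounded (λ u → ψ-bounded (u ∷ᵥ ρ))
    in ¬' ¬' compose φ ψ , ¬¬-map (from (sat-compose φ ψ)) ¬¬witness , L , λ v ¬¬v →
         decidable-stable (DecMembership._∈?_ _≟_ v L) (¬¬-map (compose⊆L v) ¬¬v)

  reach-zero : Reach 0 u v → u ≡ v
  reach-zero done = refl

  reach-suc : Reach k u v → Reach (suc k) u v
  reach-suc done         = done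
  reach-suc (step uw wv) = step uw (reach-suc wv)

  sat-reaches : ∀ k (a b : Fin n) → Sat E (reaches k a b) ρ ⇔ Reach k (ρ a) (ρ b)
  sat-reaches k a b = mk⇔ (sound k a b) (λ r → complete k a b r refl refl)
    where
    sound : ∀ k (a b : Fin n) {ρ} → Sat E (reaches k a b) ρ → Reach k (ρ a) (ρ b)
    sound zero    a b {ρ} a≡b                = subst (Reach 0 (ρ a)) a≡b done
    sound (suc k) a b {ρ} (inj₁ a≡b)         = subst (Reach (suc k) (ρ a)) a≡b done
    sound (suc k) a b     (inj₂ (w , aw , r)) = step aw (sound k zero (suc b) r)

    complete : ∀ k (a b : Fin n) {ρ u v} → Reach k u v → ρ a ≡ u → ρ b ≡ v → Sat E (reaches k a b) ρ
    complete zero    a b done a≡u b≡v = trans a≡u (sym b≡v)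
    complete (suc k) a b done a≡u b≡v = inj₁ (trans a≡u (sym b≡v))
    complete (suc k) a b (step {v = w} uw r) refl b≡v = inj₂ (w , uw , complete k zero (suc b) r refl b≡v)

  sat-⋁ : (f : ℕ → Formula n) → ∀ m → Sat E (⋁ f m) ρ ⇔ Σ ℕ λ k → k ≤ m × Sat E (f k) ρ
  sat-⋁ f m = mk⇔ (pick m) (λ (k , k≤m , fk) → inject m k≤m fk)
    where
    pick : ∀ m → Sat E (⋁ f m) ρ → Σ ℕ λ k → k ≤ m × Sat E (f k) ρ
    pick zero    f₀        = 0 , z≤n , f₀
    pick (suc m) (inj₁ fₖ) = let (k , k≤m , fk) = pick m fₖ in k , m≤n⇒m≤1+n k≤m , fk
    pick (suc m) (inj₂ fₘ) = suc m , ≤-refl , fₘ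

    inject : ∀ m {k} → k ≤ m → Sat E (f k) ρ → Sat E (⋁ f m) ρ
    inject zero    z≤n fk = fk
    inject (suc m) k≤1+m fk with m≤n⇒m<n∨m≡n k≤1+m
    ... | inj₁ (s≤s k≤m) = inj₁ (inject m k≤m fk)
    ... | inj₂ refl      = inj₂ fk

open Definability FareyE

private
  variable
    u v w x y z a b : Vertex
    f g h : BlueEdge

_≟ᴮ_ : DecidableEquality BlueEdge
_≟ᴮ_ = retract-≟ encode decode decode-encode (Product.≡-dec Fin._≟_ (List.≡-dec Bool._≟_))
  where
  encode : BlueEdge → Fin 4 × List Bool
  encode (root i)  = i , []
  encode (left e)  = map₂ (false ∷_) (encode e)
  encode (right e) = map₂ (true ∷_) (encode e)

  decode : Fin 4 × List Bool → BlueEdge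
  decode (i , [])        = root i
  decode (i , false ∷ p) = left (decode (i , p))
  decode (i , true ∷ p)  = right (decode (i , p))

  decode-encode : ∀ e → decode (encode e) ≡ e
  decode-encode (root i)  = refl
  decode-encode (left e)  = cong left (decode-encode e)
  decode-encode (right e) = cong right (decode-encode e)

_≟ᵛ_ : DecidableEquality Vertex
_≟ᵛ_ = retract-≟ encode decode decode-encode (Sum.≡-dec Fin._≟_ _≟ᴮ_)
  where
  encode : Vertex → Fin 4 ⊎ BlueEdge
  encode vA      = inj₁ zero
  encode vB      = inj₁ (suc zero)
  encode vC      = inj₁ (suc (suc zero))
  encode vD      = inj₁ (suc (suc (suc zero)))
  encode (mid e) = inj₂ e

  decode : Fin 4 ⊎ BlueEdge → Vertex
  decode (inj₁ zero)                   = vA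
  decode (inj₁ (suc zero))             = vB
  decode (inj₁ (suc (suc zero)))       = vC
  decode (inj₁ (suc (suc (suc zero)))) = vD
  decode (inj₂ e)                      = mid e

  decode-encode : ∀ v → decode (encode v) ≡ v
  decode-encode vA      = refl
  decode-encode vB      = refl
  decode-encode vC      = refl
  decode-encode vD      = refl
  decode-encode (mid e) = refl

InitialEdge : Vertex → Vertex → Set
InitialEdge u v = (u ≡ vA × v ≡ vB) ⊎ (u ≡ vB × v ≡ vA)

AB-adjacent : FareyE vA vB
AB-adjacent = inj₁ (inj₁ (refl , refl))

blue-adjacent : ∀ f → FareyE (proj₁ (ends f)) (proj₂ (ends f))
blue-adjacent f = inj₂ (f , inj₁ refl)

FareyE-sym : FareyE u v → FareyE v u
FareyE-sym (inj₁ (inj₁ uv)) = inj₁ (inj₂ (swap uv))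
FareyE-sym (inj₁ (inj₂ uv)) = inj₁ (inj₁ (swap uv))
FareyE-sym (inj₂ (f , inj₁ uv)) = inj₂ (f , inj₂ uv)
FareyE-sym (inj₂ (f , inj₂ vu)) = inj₂ (f , inj₁ vu)

data Newborn : Vertex → Set where
  newC   : Newborn vC
  newD   : Newborn vD
  newMid : ∀ h → Newborn (mid h)

newborn-unique : (p q : Newborn v) → p ≡ q
newborn-unique newC       newC       = refl
newborn-unique newD       newD       = refl
newborn-unique (newMid h) (newMid h) = refl

initial-not-newborn : InitialEdge u v → ¬ Newborn u
initial-not-newborn (inj₁ (refl , _)) ()
initial-not-newborn (inj₂ (refl , _)) ()

-- the two blue edges created together with a newborn vertex, joining it to its parents
childEdge₁ childEdge₂ : Newborn v → BlueEdge
childEdge₁ newC       = root zero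
childEdge₁ newD       = root (suc (suc zero))
childEdge₁ (newMid h) = left h
childEdge₂ newC       = root (suc zero)
childEdge₂ newD       = root (suc (suc (suc zero)))
childEdge₂ (newMid h) = right h

parent₁ parent₂ : Newborn v → Vertex
parent₁ nv = proj₁ (ends (childEdge₁ nv))
parent₂ nv = proj₁ (ends (childEdge₂ nv))

childEdge₁-born : (nv : Newborn v) → proj₂ (ends (childEdge₁ nv)) ≡ v
childEdge₁-born newC       = refl
childEdge₁-born newD       = refl
childEdge₁-born (newMid h) = refl

childEdge₂-born : (nv : Newborn v) → proj₂ (ends (childEdge₂ nv)) ≡ v
childEdge₂-born newC       = refl
childEdge₂-born newD       = refl
childEdge₂-born (newMid h) = refl

Parent : Newborn v → Vertex → Set
Parent nv u = u ≡ parent₁ nv ⊎ u ≡ parent₂ nv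

ParentOf : Vertex → Vertex → Set
ParentOf u v = Σ (Newborn v) λ nv → Parent nv u

parent-adjacent : (nv : Newborn v) → Parent nv u → FareyE u v
parent-adjacent nv (inj₁ refl) = subst (FareyE _) (childEdge₁-born nv) (blue-adjacent (childEdge₁ nv))
parent-adjacent nv (inj₂ refl) = subst (FareyE _) (childEdge₂-born nv) (blue-adjacent (childEdge₂ nv))

blue-parent : ∀ f → ParentOf (proj₁ (ends f)) (proj₂ (ends f))
blue-parent (root zero)                   = newC , inj₁ refl
blue-parent (root (suc zero))             = newC , inj₂ refl
blue-parent (root (suc (suc zero)))       = newD , inj₁ refl
blue-parent (root (suc (suc (suc zero)))) = newD , inj₂ refl
blue-parent (left h)                      = newMid h , inj₁ refl
blue-parent (right h)                     = newMid h , inj₂ refl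

adjacent-cases : FareyE u v → InitialEdge u v ⊎ ParentOf u v ⊎ ParentOf v u
adjacent-cases (inj₁ uv)              = inj₁ uv
adjacent-cases (inj₂ (f , inj₁ refl)) = inj₂ (inj₁ (blue-parent f))
adjacent-cases (inj₂ (f , inj₂ refl)) = inj₂ (inj₂ (blue-parent f))

depth : BlueEdge → ℕ
depth (root _)  = 0
depth (left h)  = suc (depth h)
depth (right h) = suc (depth h)

rank : Vertex → ℕ
rank vA      = 0
rank vB      = 0
rank vC      = 1
rank vD      = 1
rank (mid h) = suc (suc (depth h))

rank-ends : ∀ f → rank (proj₁ (ends f)) ≤ suc (depth f) × rank (proj₂ (ends f)) ≤ suc (depth f)
rank-ends (root zero)                   = z≤n , s≤s z≤n
rank-ends (root (suc zero))             = z≤n , s≤s z≤n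
rank-ends (root (suc (suc zero)))       = z≤n , s≤s z≤n
rank-ends (root (suc (suc (suc zero)))) = z≤n , s≤s z≤n
rank-ends (left f)  = m≤n⇒m≤1+n (proj₁ (rank-ends f)) , ≤-refl
rank-ends (right f) = m≤n⇒m≤1+n (proj₂ (rank-ends f)) , ≤-refl

parent-rank : ParentOf u v → rank u < rank v
parent-rank (newC     , inj₁ refl) = s≤s z≤n
parent-rank (newC     , inj₂ refl) = s≤s z≤n
parent-rank (newD     , inj₁ refl) = s≤s z≤n
parent-rank (newD     , inj₂ refl) = s≤s z≤n
parent-rank (newMid h , inj₁ refl) = s≤s (proj₁ (rank-ends h))
parent-rank (newMid h , inj₂ refl) = s≤s (proj₂ (rank-ends h))

FareyE-irrefl : ¬ FareyE v v
FareyE-irrefl vv with adjacent-cases vv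
... | inj₁ (inj₁ (refl , ()))
... | inj₁ (inj₂ (refl , ()))
... | inj₂ (inj₁ v↑v) = <-irrefl refl (parent-rank v↑v)
... | inj₂ (inj₂ v↑v) = <-irrefl refl (parent-rank v↑v)

parents : Vertex → List Vertex
parents vA      = []
parents vB      = []
parents vC      = vA ∷ vB ∷ []
parents vD      = vA ∷ vB ∷ []
parents (mid h) = proj₁ (ends h) ∷ proj₂ (ends h) ∷ []

parents-complete : ParentOf u v → u ∈ parents v
parents-complete (newC     , inj₁ refl) = here refl
parents-complete (newC     , inj₂ refl) = there (here refl)
parents-complete (newD     , inj₁ refl) = here refl
parents-complete (newD     , inj₂ refl) = there (here refl)
parents-complete (newMid h , inj₁ refl) = here refl
parents-complete (newMid h , inj₂ refl) = there (here refl)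

-- the vertices whose second parent is the given one
children : Vertex → List Vertex
children vA      = []
children vB      = vC ∷ vD ∷ []
children vC      = mid (root zero) ∷ mid (root (suc zero)) ∷ []
children vD      = mid (root (suc (suc zero))) ∷ mid (root (suc (suc (suc zero)))) ∷ []
children (mid h) = mid (left h) ∷ mid (right h) ∷ []

child-of-parent₂ : (nv : Newborn v) → v ∈ children (parent₂ nv)
child-of-parent₂ newC                                  = here refl
child-of-parent₂ newD                                  = there (here refl)
child-of-parent₂ (newMid (root zero))                   = here refl
child-of-parent₂ (newMid (root (suc zero)))             = there (here refl)
child-of-parent₂ (newMid (root (suc (suc zero))))       = here refl
child-of-parent₂ (newMid (root (suc (suc (suc zero))))) = there (here refl)
child-of-parent₂ (newMid (left h))                      = here refl
child-of-parent₂ (newMid (right h))                     = there (here refl)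

two-parents-child : ParentOf a v → ParentOf b v → a ≢ b → v ∈ children a ⊎ v ∈ children b
two-parents-child (nv , inj₂ refl) _                 _   = inj₁ (child-of-parent₂ nv)
two-parents-child _                (nv , inj₂ refl) _   = inj₂ (child-of-parent₂ nv)
two-parents-child (nv , inj₁ refl) (nv′ , inj₁ refl) a≢b =
  ⊥-elim (a≢b (cong parent₁ (newborn-unique nv nv′)))

initial-unique : InitialEdge v a → InitialEdge v b → a ≡ b
initial-unique (inj₁ (refl , refl)) (inj₁ (_ , refl)) = refl
initial-unique (inj₂ (refl , refl)) (inj₂ (_ , refl)) = refl
initial-unique (inj₁ (refl , _))    (inj₂ (() , _))
initial-unique (inj₂ (refl , _))    (inj₁ (() , _))

commonNeighbours : Vertex → Vertex → List Vertex
commonNeighbours a b = parents a ++ parents b ++ children a ++ children b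

commonNeighbours-complete : FareyE a b → FareyE v a → FareyE v b → v ∈ commonNeighbours a b
commonNeighbours-complete {a} {b} ab va vb with adjacent-cases va | adjacent-cases vb
... | inj₂ (inj₁ v↑a) | _ = ∈-++⁺ˡ (parents-complete v↑a)
... | _ | inj₂ (inj₁ v↑b) = ∈-++⁺ʳ (parents a) (∈-++⁺ˡ (parents-complete v↑b))
... | inj₂ (inj₂ a↑v) | inj₂ (inj₂ b↑v) =
  ∈-++⁺ʳ (parents a) (∈-++⁺ʳ (parents b) ([ ∈-++⁺ˡ , ∈-++⁺ʳ (children a) ]′
    (two-parents-child a↑v b↑v λ { refl → FareyE-irrefl ab })))
... | inj₁ va-initial | inj₂ (inj₂ (nv , _)) = ⊥-elim (initial-not-newborn va-initial nv)
... | inj₂ (inj₂ (nv , _)) | inj₁ vb-initial = ⊥-elim (initial-not-newborn vb-initial nv)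
... | inj₁ va-initial | inj₁ vb-initial with initial-unique va-initial vb-initial
...   | refl = ⊥-elim (FareyE-irrefl ab)

module _ (S : Vertex → Set) (closed : TriangleClosed S) where

  private
    A–C : FareyE vA vC
    A–C = blue-adjacent (root zero)
    B–C : FareyE vB vC
    B–C = blue-adjacent (root (suc zero))
    A–D : FareyE vA vD
    A–D = blue-adjacent (root (suc (suc zero)))
    B–D : FareyE vB vD
    B–D = blue-adjacent (root (suc (suc (suc zero))))

    closed-mid : ∀ h → S (proj₁ (ends h)) → S (proj₂ (ends h)) → S (mid h)
    closed-mid h = closed (blue-adjacent h) (FareyE-sym (blue-adjacent (left h))) (FareyE-sym (blue-adjacent (right h)))

    closed-initial : ∀ f → S (proj₁ (ends f)) → S (proj₂ (ends f)) → S vA × S vB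
    closed-initial (root zero)                   sA sC = sA , closed A–C (FareyE-sym AB-adjacent) B–C sA sC
    closed-initial (root (suc zero))             sB sC = closed B–C AB-adjacent A–C sB sC , sB
    closed-initial (root (suc (suc zero)))       sA sD = sA , closed A–D (FareyE-sym AB-adjacent) B–D sA sD
    closed-initial (root (suc (suc (suc zero)))) sB sD = closed B–D AB-adjacent A–D sB sD , sB
    closed-initial (left f)  s₁ sm = closed-initial f s₁
      (closed (blue-adjacent (left f)) (FareyE-sym (blue-adjacent f)) (blue-adjacent (right f)) s₁ sm)
    closed-initial (right f) s₂ sm = closed-initial f
      (closed (blue-adjacent (right f)) (blue-adjacent f) (blue-adjacent (left f)) s₂ sm) s₂

    module _ (sA : S vA) (sB : S vB) where
      sC : S vC
      sC = closed AB-adjacent (FareyE-sym A–C) (FareyE-sym B–C) sA sB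
      sD : S vD
      sD = closed AB-adjacent (FareyE-sym A–D) (FareyE-sym B–D) sA sB

      closed-ends : ∀ f → S (proj₁ (ends f)) × S (proj₂ (ends f))
      closed-ends (root zero)                   = sA , sC
      closed-ends (root (suc zero))             = sB , sC
      closed-ends (root (suc (suc zero)))       = sA , sD
      closed-ends (root (suc (suc (suc zero)))) = sB , sD
      closed-ends (left f)  = proj₁ (closed-ends f) , closed-mid f (proj₁ (closed-ends f)) (proj₂ (closed-ends f))
      closed-ends (right f) = proj₂ (closed-ends f) , closed-mid f (proj₁ (closed-ends f)) (proj₂ (closed-ends f))

      closed-everywhere : ∀ z → S z
      closed-everywhere vA      = sA
      closed-everywhere vB      = sB
      closed-everywhere vC      = sC
      closed-everywhere vD      = sD
      closed-everywhere (mid h) = closed-mid h (proj₁ (closed-ends h)) (proj₂ (closed-ends h))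

  triangleClosed-everywhere : FareyE a b → S a → S b → ∀ z → S z
  triangleClosed-everywhere (inj₁ (inj₁ (refl , refl))) sA sB = closed-everywhere sA sB
  triangleClosed-everywhere (inj₁ (inj₂ (refl , refl))) sB sA = closed-everywhere sA sB
  triangleClosed-everywhere (inj₂ (f , inj₁ refl)) s₁ s₂ = uncurry closed-everywhere (closed-initial f s₁ s₂)
  triangleClosed-everywhere (inj₂ (f , inj₂ refl)) s₂ s₁ = uncurry closed-everywhere (closed-initial f s₁ s₂)

some-neighbour : ∀ v → Σ Vertex (FareyE v)
some-neighbour vA      = vB , AB-adjacent
some-neighbour vB      = vA , FareyE-sym AB-adjacent
some-neighbour vC      = vA , FareyE-sym (blue-adjacent (root zero))
some-neighbour vD      = vA , FareyE-sym (blue-adjacent (root (suc (suc zero))))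
some-neighbour (mid h) = proj₁ (ends h) , FareyE-sym (blue-adjacent (left h))

connected : ∀ u v → Σ ℕ λ k → Reach k u v
connected u v =
  let (w , vw) = some-neighbour v
  in triangleClosed-everywhere (λ u → Σ ℕ λ k → Reach k u v)
       (λ _ ua _ (k , a⇝v) _ → suc k , step ua a⇝v)
       vw (0 , done) (1 , step (FareyE-sym vw) done) u

edge-uniformlyAlgebraic : {n : ℕ} (ρ : Fin n → Vertex) (i j : Fin n) → FareyE (ρ i) (ρ j) →
                          ∀ z → UniformlyAlgebraic ρ z
edge-uniformlyAlgebraic ρ i j ρi–ρj =
  triangleClosed-everywhere (UniformlyAlgebraic ρ)
    (uniformlyAlgebraic-triangle λ a b → commonNeighbours a b , λ v ab va vb → commonNeighbours-complete ab va vb)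
    ρi–ρj (uniformlyAlgebraic-var i) (uniformlyAlgebraic-var j)

data _⊒_ : BlueEdge → BlueEdge → Set where
  ⊒-refl  : h ⊒ h
  ⊒-left  : g ⊒ h → left g ⊒ h
  ⊒-right : g ⊒ h → right g ⊒ h

⊒-trans : f ⊒ g → g ⊒ h → f ⊒ h
⊒-trans ⊒-refl        g⊒h = g⊒h
⊒-trans (⊒-left f⊒g)  g⊒h = ⊒-left (⊒-trans f⊒g g⊒h)
⊒-trans (⊒-right f⊒g) g⊒h = ⊒-right (⊒-trans f⊒g g⊒h)

⊒-depth : g ⊒ h → depth h ≤ depth g
⊒-depth ⊒-refl        = ≤-refl
⊒-depth (⊒-left g⊒h)  = m≤n⇒m≤1+n (⊒-depth g⊒h)
⊒-depth (⊒-right g⊒h) = m≤n⇒m≤1+n (⊒-depth g⊒h)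

EndOf : Vertex → BlueEdge → Set
EndOf w f = w ≡ proj₁ (ends f) ⊎ w ≡ proj₂ (ends f)

BornBelow : BlueEdge → Vertex → Set
BornBelow h v = Σ BlueEdge λ g → v ≡ mid g × g ⊒ h

incident-cases : FareyE u w → InitialEdge u w ⊎ Σ BlueEdge λ f → EndOf u f × EndOf w f
incident-cases (inj₁ uw)              = inj₁ uw
incident-cases (inj₂ (f , inj₁ refl)) = inj₂ (f , inj₁ refl , inj₂ refl)
incident-cases (inj₂ (f , inj₂ refl)) = inj₂ (f , inj₂ refl , inj₁ refl)

newborn-incident : ∀ f → EndOf y f → (ny : Newborn y) → f ⊒ childEdge₁ ny ⊎ f ⊒ childEdge₂ ny
newborn-incident (root zero)                   (inj₁ refl) ()
newborn-incident (root (suc zero))             (inj₁ refl) ()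
newborn-incident (root (suc (suc zero)))       (inj₁ refl) ()
newborn-incident (root (suc (suc (suc zero)))) (inj₁ refl) ()
newborn-incident (root zero)                   (inj₂ refl) newC = inj₁ ⊒-refl
newborn-incident (root (suc zero))             (inj₂ refl) newC = inj₂ ⊒-refl
newborn-incident (root (suc (suc zero)))       (inj₂ refl) newD = inj₁ ⊒-refl
newborn-incident (root (suc (suc (suc zero)))) (inj₂ refl) newD = inj₂ ⊒-refl
newborn-incident (left f)  (inj₁ y-end) ny = Sum.map ⊒-left ⊒-left (newborn-incident f (inj₁ y-end) ny)
newborn-incident (right f) (inj₁ y-end) ny = Sum.map ⊒-right ⊒-right (newborn-incident f (inj₂ y-end) ny)
newborn-incident (left f)  (inj₂ refl) (newMid f) = inj₁ ⊒-refl
newborn-incident (right f) (inj₂ refl) (newMid f) = inj₂ ⊒-refl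

born-below-incident : BornBelow h w → EndOf w f → f ⊒ h
born-below-incident {f = f} (g , refl , g⊒h) w-end =
  [ (λ f⊒lg → ⊒-trans f⊒lg (⊒-left g⊒h)) , (λ f⊒rg → ⊒-trans f⊒rg (⊒-right g⊒h)) ]′
    (newborn-incident f w-end (newMid g))

end-below : g ⊒ h → EndOf w g → BornBelow h w ⊎ EndOf w h
end-below ⊒-refl                w-end        = inj₂ w-end
end-below (⊒-left g⊒h)          (inj₁ w-end) = end-below g⊒h (inj₁ w-end)
end-below (⊒-left {g} g⊒h)      (inj₂ w≡mid) = inj₁ (g , w≡mid , g⊒h)
end-below (⊒-right g⊒h)         (inj₁ w-end) = end-below g⊒h (inj₂ w-end)
end-below (⊒-right {g} g⊒h)     (inj₂ w≡mid) = inj₁ (g , w≡mid , g⊒h)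

born-below-closed : BornBelow h u → FareyE u w → BornBelow h w ⊎ EndOf w h
born-below-closed u-below uw with incident-cases uw
born-below-closed (g , refl , _) uw | inj₁ initial = ⊥-elim (initial-not-newborn initial (newMid g))
born-below-closed u-below        uw | inj₂ (f , u-end , w-end) =
  end-below (born-below-incident {f = f} u-below u-end) w-end

born-below-rank : BornBelow h v → suc (depth h) < rank v
born-below-rank (g , refl , g⊒h) = s≤s (s≤s (⊒-depth g⊒h))

rank-childEdge : (ny : Newborn y) → rank y ≡ suc (depth (childEdge₁ ny)) × rank y ≡ suc (depth (childEdge₂ ny))
rank-childEdge newC       = refl , refl
rank-childEdge newD       = refl , refl
rank-childEdge (newMid h) = refl , refl

Descendant : Newborn y → Vertex → Set
Descendant {y} ny v = v ≡ y ⊎ BornBelow (childEdge₁ ny) v ⊎ BornBelow (childEdge₂ ny) v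

descendant-rank : (ny : Newborn y) → Descendant ny v → v ≡ y ⊎ rank y < rank v
descendant-rank ny (inj₁ v≡y)          = inj₁ v≡y
descendant-rank ny (inj₂ (inj₁ below)) =
  inj₂ (subst (_< _) (sym (proj₁ (rank-childEdge ny))) (born-below-rank below))
descendant-rank ny (inj₂ (inj₂ below)) =
  inj₂ (subst (_< _) (sym (proj₂ (rank-childEdge ny))) (born-below-rank below))

childEdge₁-boundary : (ny : Newborn y) → BornBelow (childEdge₁ ny) w ⊎ EndOf w (childEdge₁ ny) →
                      Descendant ny w ⊎ Parent ny w
childEdge₁-boundary ny (inj₁ below)       = inj₁ (inj₂ (inj₁ below))
childEdge₁-boundary ny (inj₂ (inj₁ w≡p₁)) = inj₂ (inj₁ w≡p₁)
childEdge₁-boundary ny (inj₂ (inj₂ w≡y))  = inj₁ (inj₁ (trans w≡y (childEdge₁-born ny)))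

childEdge₂-boundary : (ny : Newborn y) → BornBelow (childEdge₂ ny) w ⊎ EndOf w (childEdge₂ ny) →
                      Descendant ny w ⊎ Parent ny w
childEdge₂-boundary ny (inj₁ below)       = inj₁ (inj₂ (inj₂ below))
childEdge₂-boundary ny (inj₂ (inj₁ w≡p₂)) = inj₂ (inj₂ w≡p₂)
childEdge₂-boundary ny (inj₂ (inj₂ w≡y))  = inj₁ (inj₁ (trans w≡y (childEdge₂-born ny)))

descendants-closed : (ny : Newborn y) → Descendant ny u → FareyE u w → Descendant ny w ⊎ Parent ny w
descendants-closed ny (inj₁ refl) yw with incident-cases yw
... | inj₁ initial = ⊥-elim (initial-not-newborn initial ny)
... | inj₂ (f , y-end , w-end) with newborn-incident f y-end ny
...   | inj₁ f⊒c₁ = childEdge₁-boundary ny (end-below f⊒c₁ w-end)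
...   | inj₂ f⊒c₂ = childEdge₂-boundary ny (end-below f⊒c₂ w-end)
descendants-closed ny (inj₂ (inj₁ below)) uw = childEdge₁-boundary ny (born-below-closed below uw)
descendants-closed ny (inj₂ (inj₂ below)) uw = childEdge₂-boundary ny (born-below-closed below uw)

exit-through-parent : (ny : Newborn y) → ¬ Descendant ny x → Descendant ny v → Reach k v x →
                      Σ ℕ λ k′ → k ≡ suc k′ × Σ Vertex λ p → Parent ny p × Reach k′ p x
exit-through-parent ny x∉ v∈ done = ⊥-elim (x∉ v∈)
exit-through-parent ny x∉ v∈ (step {k = k′} vw w⇝x) with descendants-closed ny v∈ vw
... | inj₂ w-parent = k′ , refl , _ , w-parent , w⇝x
... | inj₁ w∈ with exit-through-parent ny x∉ w∈ w⇝x
...   | _ , refl , p , p-parent , p⇝x = k′ , refl , p , p-parent , reach-suc p⇝x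

module _ {n : ℕ} (ρ : Fin n → Vertex) (i j : Fin n) (ny : Newborn (ρ j)) (x∉ : ¬ Descendant ny (ρ i)) where

  -- v is adjacent to y = ρ j and, for some k ≤ M, within distance k of x = ρ i while y is not
  closerNeighbour : ℕ → Formula (suc n)
  closerNeighbour M = rel zero (suc j) ∧' ⋁ (λ k → reaches k zero (suc i) ∧' (¬' reaches k (suc j) (suc i))) M

  closerNeighbour-parent : ∀ M v → Sat FareyE (closerNeighbour M) (v ∷ᵥ ρ) → Parent ny v
  closerNeighbour-parent M v (vy , closer)
    with to (sat-⋁ _ M) closer | descendants-closed ny (inj₁ refl) (FareyE-sym vy)
  ... | _ | inj₂ v-parent = v-parent
  ... | k , _ , v⇝x , ¬y⇝x | inj₁ v∈ with exit-through-parent ny x∉ v∈ (to (sat-reaches k zero (suc i)) v⇝x)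
  ...   | k′ , refl , p , p-parent , p⇝x =
    ⊥-elim (¬y⇝x (from (sat-reaches k (suc j) (suc i)) (step (FareyE-sym (parent-adjacent ny p-parent)) p⇝x)))

  ¬¬-closer-parent : ∀ M → Reach (suc M) (ρ j) (ρ i) →
                     ¬ ¬ Σ Vertex λ p → Parent ny p × Sat FareyE (closerNeighbour M) (p ∷ᵥ ρ)
  ¬¬-closer-parent M y⇝x = ¬¬-map closer-parent (¬¬-jump (x∉ ∘ inj₁ ∘ sym ∘ reach-zero) y⇝x)
    where
    closer-parent : (Σ ℕ λ d → d ≤ M × Reach (suc d) (ρ j) (ρ i) × ¬ Reach d (ρ j) (ρ i)) →
                    Σ Vertex λ p → Parent ny p × Sat FareyE (closerNeighbour M) (p ∷ᵥ ρ)
    closer-parent (d , d≤M , y⇝x , ¬y⇝x) with exit-through-parent ny x∉ (inj₁ refl) y⇝x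
    ... | .d , refl , p , p-parent , p⇝x =
      p , p-parent , parent-adjacent ny p-parent ,
      from (sat-⋁ _ M)
        (d , d≤M , from (sat-reaches d zero (suc i)) p⇝x , ¬y⇝x ∘ to (sat-reaches d (suc j) (suc i)))

  newborn-algebraic : ∀ z → Algebraic ρ z
  newborn-algebraic z =
    let (ψ , ψ-bounded , ψ-sat) = uniformlyAlgebraic-∨ (over-parent (inj₁ refl)) (over-parent (inj₂ refl))
        (M , y⇝x) = connected (ρ j) (ρ i)
    in algebraic-¬¬-trans _≟ᵛ_ (closerNeighbour M) ψ
         (parent₁ ny ∷ parent₂ ny ∷ [] ,
          λ v closer → [ here , there ∘ here ]′ (closerNeighbour-parent M v closer))
         ψ-bounded
         (¬¬-map (λ (p , p-parent , closer) → p , closer , ψ-sat p-parent) (¬¬-closer-parent M (reach-suc y⇝x)))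
    where
    over-parent : ∀ {p} → Parent ny p → UniformlyAlgebraic (p ∷ᵥ ρ) z
    over-parent p-parent = edge-uniformlyAlgebraic _ zero (suc j) (parent-adjacent ny p-parent) z

not-descendant : (ny : Newborn y) → x ≢ y → rank x ≤ rank y → ¬ Descendant ny x
not-descendant ny x≢y rx≤ry x∈ with descendant-rank ny x∈
... | inj₁ x≡y   = x≢y x≡y
... | inj₂ ry<rx = <-irrefl refl (<-≤-trans ry<rx rx≤ry)

newborn-pair-algebraic : (ny : Newborn y) → x ≢ y → rank x ≤ rank y →
                         ∀ z → Algebraic (x ∷ᵥ y ∷ᵥ []ᵥ) z
newborn-pair-algebraic ny x≢y rx≤ry = newborn-algebraic _ zero (suc zero) ny (not-descendant ny x≢y rx≤ry)

pair-algebraic : ∀ x y → x ≢ y → rank x ≤ rank y → ∀ z → Algebraic (x ∷ᵥ y ∷ᵥ []ᵥ) z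
pair-algebraic x vC      = newborn-pair-algebraic newC
pair-algebraic x vD      = newborn-pair-algebraic newD
pair-algebraic x (mid h) = newborn-pair-algebraic (newMid h)
pair-algebraic vA vB _ _ =
  uniformlyAlgebraic⇒algebraic ∘ edge-uniformlyAlgebraic _ zero (suc zero) AB-adjacent
pair-algebraic vB vA _ _ =
  uniformlyAlgebraic⇒algebraic ∘ edge-uniformlyAlgebraic _ zero (suc zero) (FareyE-sym AB-adjacent)
pair-algebraic vA      vA x≢x _ = ⊥-elim (x≢x refl)
pair-algebraic vB      vB x≢x _ = ⊥-elim (x≢x refl)
pair-algebraic vC      vA _ ()
pair-algebraic vD      vA _ ()
pair-algebraic (mid _) vA _ ()
pair-algebraic vC      vB _ ()
pair-algebraic vD      vB _ ()
pair-algebraic (mid _) vB _ ()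

corollary3p2 : (x y : Vertex) → x ≢ y →
    (z : Vertex) → InAcl FareyE (λ v → v ≡ x ⊎ v ≡ y) z
corollary3p2 x y x≢y z with ≤-total (rank x) (rank y)
... | inj₁ rx≤ry = algebraic⇒InAcl (λ v → v ≡ x ⊎ v ≡ y)
                     (λ { zero → inj₁ refl ; (suc zero) → inj₂ refl })
                     (pair-algebraic x y x≢y rx≤ry z)
... | inj₂ ry≤rx = algebraic⇒InAcl (λ v → v ≡ x ⊎ v ≡ y)
                     (λ { zero → inj₂ refl ; (suc zero) → inj₁ refl })
                     (pair-algebraic y x (x≢y ∘ sym) ry≤rx z)
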